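{- Let $G$ and $H$ be graphs such that $\mathcal{I}^2_{\mathrm{J}}(G)$ and $\mathcal{I}^2_{\mathrm{J}}(H)$ are non-empty and connected, and such that each of $G,H$ satisfies: whenever it is written as a complete join $G_1\bowtie G_2$ of two non-empty graphs, both $G_1$ and $G_2$ contain an independent set of size $2$. Suppose $\mathcal{I}^2_{\mathrm{J}}(G)\cong\mathcal{I}^2_{\mathrm{J}}(H)$. Then $G\cong H$, unless $\mathcal{I}^2_{\mathrm{J}}(G)$ is a triangle $K_3$ (in which case the complement $\overline{G}$ is either $K_3$ or the claw $K_{1,3}$).
   Context: All graphs are finite and simple. $\mathcal{I}^2_{\mathrm{J}}(G)$ is the graph whose vertices are the independent sets of $G$ of size exactly $2$, with $I,I'$ adjacent iff $I'=(I\setminus\{x\})\cup\{y\}$ for some $x\in I$, $y\notin I$. The complete join $G_1\bowtie G_2$ is the disjoint union of $G_1$ and $G_2$ together with all edges between $V(G_1)$ and $V(G_2)$. $\overline{G}$ denotes the complement of $G$. -}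

module Defs where

open import Data.Nat using (ℕ; suc)
open import Data.Fin using (Fin; zero; suc; _<_)
open import Data.Bool using (Bool; true; false)
open import Data.Product using (Σ; ∃; ∃-syntax; _×_; _,_)
open import Data.Sum using (_⊎_; inj₁; inj₂)
open import Data.Unit using (⊤)
open import Relation.Nullary using (¬_)
open import Relation.Binary.PropositionalEquality using (_≡_; _≢_)
open import Relation.Binary.Construct.Closure.ReflexiveTransitive using (Star)
open import Function.Bundles using (_⇔_)

record Graph : Set₁ where
  field
    V   : Set
    Adj : V → V → Set
open Graph public

record _≅_ (G H : Graph) : Set where
  field
    to      : V G → V H
    from    : V H → V G
    to∘from : ∀ y → to (from y) ≡ y
    from∘to : ∀ x → from (to x) ≡ x
    adj⇔    : ∀ x y → Adj G x y ⇔ Adj H (to x) (to y)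

NonEmpty : Graph → Set
NonEmpty G = V G

Connected : Graph → Set
Connected G = ∀ x y → Star (Adj G) x y

_⋈_ : Graph → Graph → Graph
G₁ ⋈ G₂ = record { V = V G₁ ⊎ V G₂ ; Adj = adj }
  where
  adj : V G₁ ⊎ V G₂ → V G₁ ⊎ V G₂ → Set
  adj (inj₁ a) (inj₁ b) = Adj G₁ a b
  adj (inj₂ a) (inj₂ b) = Adj G₂ a b
  adj (inj₁ _) (inj₂ _) = ⊤
  adj (inj₂ _) (inj₁ _) = ⊤

co : Graph → Graph
co G = record { V = V G ; Adj = λ x y → x ≢ y × ¬ Adj G x y }

HasIndep2 : Graph → Set
HasIndep2 G = Σ (V G) λ u → Σ (V G) λ v → u ≢ v × ¬ Adj G u v

K3 : Graph
K3 = record { V = Fin 3 ; Adj = λ u v → u ≢ v }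

Claw : Graph
Claw = record { V = Fin 4 ; Adj = λ u v → (u ≡ zero × v ≢ zero) ⊎ (u ≢ zero × v ≡ zero) }

record FinGraph : Set where
  field
    n      : ℕ
    adj    : Fin n → Fin n → Bool
    sym    : ∀ u v → adj u v ≡ adj v u
    irrefl : ∀ v → adj v v ≡ false
open FinGraph public

⟦_⟧ : FinGraph → Graph
⟦ G ⟧ = record { V = Fin (n G) ; Adj = λ u v → adj G u v ≡ true }

record Indep2 (G : FinGraph) : Set where
  constructor ind2
  field
    fst  : Fin (n G)
    snd  : Fin (n G)
    lt   : fst < snd
    nadj : adj G fst snd ≡ false
open Indep2 public

_∈I_ : {G : FinGraph} → Fin (n G) → Indep2 G → Set
z ∈I I = z ≡ fst I ⊎ z ≡ snd I

TJ : (G : FinGraph) → Indep2 G → Indep2 G → Set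
TJ G I I' = Σ (Fin (n G)) λ x → Σ (Fin (n G)) λ y →
  (x ∈I I) × ¬ (y ∈I I) ×
  (∀ z → (z ∈I I') ⇔ (((z ∈I I) × z ≢ x) ⊎ z ≡ y))

I2J : FinGraph → Graph
I2J G = record { V = Indep2 G ; Adj = TJ G }

JoinCondition : FinGraph → Set
JoinCondition G = ∀ (G₁ G₂ : FinGraph) → Fin (n G₁) → Fin (n G₂) →
  ⟦ G ⟧ ≅ (⟦ G₁ ⟧ ⋈ ⟦ G₂ ⟧) → HasIndep2 ⟦ G₁ ⟧ × HasIndep2 ⟦ G₂ ⟧

{-# OPTIONS --safe #-}
module Submission where

-- An independent 2-set of G is an edge of its complement, and two such sets are adjacent in
-- I²_J(G) exactly when they are distinct and share a vertex: I²_J(G) is the line graph of co G,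
-- and the statement is Whitney's theorem for co G and co H.  The join condition says that G has
-- no universal vertex (G ≅ K₁ ⋈ (G ∖ v) otherwise), so every vertex lies in some 2-set.
--
-- If the isomorphism φ maps the star of every vertex (the 2-sets through it) onto a star, in
-- both directions, then sending each vertex to the centre of the image of its star is a
-- bijection, and it preserves non-adjacency because non-adjacent vertices are exactly those
-- sharing a 2-set.  Otherwise three 2-sets through a vertex a go to the three sides of a
-- triangle.  Connectivity then confines co G to a and three leaves, and co H to the triangle
-- plus at most one vertex z, joined to the corner opposite a side exactly when the two
-- corresponding leaves are joined.  With no such z, co G is the claw and co H the triangle;
-- with it, the two four-vertex graphs are matched by a permutation checked by evaluation.
-- When a single 2-set covers everything, both graphs are edgeless on two vertices.

open import Defs renaming (sym to adj-sym)
open import Data.Nat.Base using (ℕ; suc)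
open import Data.Fin.Base using (Fin; zero; suc; _<_; punchIn; punchOut)
open import Data.Fin.Patterns using (0F; 1F; 2F; 3F)
open import Data.Fin.Properties as Fin
  using (all?; any?; <-cmp; <-irrelevant; <⇒≢; <-asym; punchInᵢ≢i; punchIn-punchOut; punchOut-punchIn; punchOut-cong)
open import Data.Bool.Base using (Bool; true; false)
import Data.Bool.Properties as Bool
open import Data.Empty using (⊥; ⊥-elim)
open import Data.Product.Base using (Σ; _×_; _,_; proj₁; proj₂)
open import Data.Sum.Base using (_⊎_; inj₁; inj₂; [_,_]′; map₂)
open import Data.Vec.Base using (Vec; []; _∷_; lookup; tabulate)
open import Data.Vec.Membership.Propositional using (_∈_)
open import Data.Vec.Relation.Unary.Any as Any using (here; there; index)
open import Data.Vec.Relation.Unary.Any.Properties using (lookup-index)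
open import Data.Vec.Relation.Unary.All using ([]; _∷_)
open import Data.Vec.Relation.Unary.AllPairs using (allPairs?; []; _∷_)
open import Data.Vec.Relation.Unary.Unique.Propositional using (Unique)
open import Data.Vec.Relation.Unary.Unique.Propositional.Properties using (lookup-injective; tabulate⁺)
open import Data.Vec.Relation.Unary.All.Properties as All using ()
open import Data.Vec.Membership.Propositional.Properties using (∈-lookup; ∈-tabulate⁺)
open import Function.Base using (_∘_; id)
open import Function.Bundles using (_⇔_; mk⇔; Equivalence)
open import Function.Construct.Composition using (_⇔-∘_)
open import Function.Construct.Symmetry using (⇔-sym)
open import Relation.Nullary using (¬_; Dec; yes; no; ¬?)
open import Relation.Nullary.Decidable using (map′; decidable-stable; True; from-yes; toWitness; _×-dec_; _⊎-dec_; _→-dec_)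
open import Relation.Binary.PropositionalEquality
  using (_≡_; _≢_; refl; sym; trans; cong; cong₂; subst; subst₂; ≢-sym)
open import Relation.Binary.Definitions using (tri<; tri≈; tri>)
open import Relation.Binary.Construct.Closure.ReflexiveTransitive using (Star; ε; _◅_)
open import Axiom.UniquenessOfIdentityProofs using (module Decidable⇒UIP)

module ⇔ = Equivalence

-- Isomorphisms and connectivity

≅-sym : ∀ {A B} → A ≅ B → B ≅ A
≅-sym {B = B} φ = record
  { to = from ; from = to ; to∘from = from∘to ; from∘to = to∘from
  ; adj⇔ = λ x y → mk⇔
      (λ e → ⇔.from (adj⇔ (from x) (from y)) (subst₂ (Adj B) (sym (to∘from x)) (sym (to∘from y)) e))
      (λ e → subst₂ (Adj B) (to∘from x) (to∘from y) (⇔.to (adj⇔ (from x) (from y)) e)) }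
  where open _≅_ φ

≅-trans : ∀ {A B C} → A ≅ B → B ≅ C → A ≅ C
≅-trans φ ψ = record
  { to = ψ.to ∘ φ.to ; from = φ.from ∘ ψ.from
  ; to∘from = λ z → trans (cong ψ.to (φ.to∘from (ψ.from z))) (ψ.to∘from z)
  ; from∘to = λ x → trans (cong φ.from (ψ.from∘to (φ.to x))) (φ.from∘to x)
  ; adj⇔ = λ x y → mk⇔ (⇔.to (ψ.adj⇔ _ _) ∘ ⇔.to (φ.adj⇔ x y)) (⇔.from (φ.adj⇔ x y) ∘ ⇔.from (ψ.adj⇔ _ _)) }
  where module φ = _≅_ φ
        module ψ = _≅_ ψ

≅-co : ∀ {A B} → A ≅ B → co A ≅ co B
≅-co φ = record
  { to = to ; from = from ; to∘from = to∘from ; from∘to = from∘to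
  ; adj⇔ = λ x y → mk⇔
      (λ (x≢y , ¬xy) → (λ e → x≢y (trans (sym (from∘to x)) (trans (cong from e) (from∘to y))))
                     , ¬xy ∘ ⇔.from (adj⇔ x y))
      (λ (x≢y , ¬xy) → x≢y ∘ cong to , ¬xy ∘ ⇔.to (adj⇔ x y)) }
  where open _≅_ φ

first-step : ∀ {A : Set} {R : A → A → Set} {x y} → Star R x y → x ≢ y → Σ A (R x)
first-step ε x≢x = ⊥-elim (x≢x refl)
first-step (x→z ◅ _) _ = _ , x→z

connected⇒neighbour : ∀ Γ → Connected Γ → (∀ (x y : V Γ) → Dec (x ≡ y)) →
  ∀ {x₁ x₂} → x₁ ≢ x₂ → ∀ x → Σ (V Γ) (Adj Γ x)
connected⇒neighbour Γ connected _≟_ {x₁} {x₂} x₁≢x₂ x with x ≟ x₁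
... | yes refl = first-step (connected x x₂) x₁≢x₂
... | no x≢x₁ = first-step (connected x x₁) x≢x₁

-- Isomorphisms from enumerations and adjacency tables

enumeration⇒≅ : (Γ : Graph) {m : ℕ} (xs : Vec (V Γ) m) → Unique xs → (∀ x → x ∈ xs) →
  (R : Fin m → Fin m → Set) → (∀ i j → Adj Γ (lookup xs i) (lookup xs j) ⇔ R i j) →
  Γ ≅ record { V = Fin m ; Adj = R }
enumeration⇒≅ Γ xs unique complete R adj⇔ = record
  { to = position ; from = lookup xs ; to∘from = to∘from ; from∘to = from∘to
  ; adj⇔ = λ x y → subst₂ (λ u v → Adj Γ u v ⇔ R (position x) (position y))
                          (from∘to x) (from∘to y) (adj⇔ (position x) (position y)) }
  where
  position : V Γ → Fin _
  position = index ∘ complete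
  from∘to : ∀ x → lookup xs (position x) ≡ x
  from∘to x = sym (lookup-index (complete x))
  to∘from : ∀ i → position (lookup xs i) ≡ i
  to∘from i = lookup-injective unique _ _ (from∘to (lookup xs i))

module _ {m : ℕ} {R S : Fin m → Fin m → Set} (R? : ∀ i j → Dec (R i j)) (S? : ∀ i j → Dec (S i j)) where

  Relabelling : Vec (Fin m) m → Set
  Relabelling xs = Unique xs × (∀ i → i ∈ xs) ×
    (∀ i j → (R (lookup xs i) (lookup xs j) → S i j) × (S i j → R (lookup xs i) (lookup xs j)))

  relabelling? : ∀ xs → Dec (Relabelling xs)
  relabelling? xs =
    allPairs? (λ i j → ¬? (i Fin.≟ j)) xs ×-dec
    all? (λ i → Any.any? (i Fin.≟_) xs) ×-dec
    all? λ i → all? λ j → (R? (lookup xs i) (lookup xs j) →-dec S? i j) ×-dec (S? i j →-dec R? (lookup xs i) (lookup xs j))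

  ≅-by-evaluation : (xs : Vec (Fin m) m) → {True (relabelling? xs)} →
    record { V = Fin m ; Adj = R } ≅ record { V = Fin m ; Adj = S }
  ≅-by-evaluation xs {check} with toWitness check
  ... | unique , complete , agree =
    enumeration⇒≅ _ xs unique complete S λ i j → mk⇔ (proj₁ (agree i j)) (proj₂ (agree i j))

≡-true-⇔ : ∀ {b c : Bool} → b ≡ c → (b ≡ true) ⇔ (c ≡ true)
≡-true-⇔ b≡c = mk⇔ (subst (_≡ true) b≡c) (subst (_≡ true) (sym b≡c))

Bool-≡ : ∀ {b c : Bool} → (b ≡ false → c ≡ false) → (c ≡ false → b ≡ false) → b ≡ c
Bool-≡ {true} {true} _ _ = refl
Bool-≡ {false} {false} _ _ = refl
Bool-≡ {true} {false} _ c⇒b with c⇒b refl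
... | ()
Bool-≡ {false} {true} b⇒c _ with b⇒c refl
... | ()

complete-graph-≅ : (Γ : Graph) {m : ℕ} (xs : Vec (V Γ) m) → Unique xs → (∀ x → x ∈ xs) →
  (∀ x y → Adj Γ x y ⇔ x ≢ y) → Γ ≅ record { V = Fin m ; Adj = _≢_ }
complete-graph-≅ Γ xs unique complete adj⇔≢ = enumeration⇒≅ Γ xs unique complete _≢_ λ i j →
  mk⇔ (λ xᵢ≢xⱼ → xᵢ≢xⱼ ∘ cong (lookup xs)) (λ i≢j → i≢j ∘ lookup-injective unique i j)
    ⇔-∘ adj⇔≢ (lookup xs i) (lookup xs j)

TableGraph : {m : ℕ} → (Fin m → Fin m → Bool) → Graph
TableGraph {m} T = record { V = Fin m ; Adj = λ i j → T i j ≡ true }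

≅-tables-by-evaluation : {m : ℕ} {T T′ : Fin m → Fin m → Bool} (xs : Vec (Fin m) m) →
  {True (relabelling? (λ i j → T i j Bool.≟ true) (λ i j → T′ i j Bool.≟ true) xs)} → TableGraph T ≅ TableGraph T′
≅-tables-by-evaluation {T = T} {T′} = ≅-by-evaluation (λ i j → T i j Bool.≟ true) (λ i j → T′ i j Bool.≟ true)

table₄ : (b₀₁ b₀₂ b₀₃ b₁₂ b₁₃ b₂₃ : Bool) → Fin 4 → Fin 4 → Bool
table₄ b₀₁ b₀₂ b₀₃ b₁₂ b₁₃ b₂₃ i j = lookup (lookup rows i) j
  where
  rows : Vec (Vec Bool 4) 4
  rows = (false ∷ b₀₁   ∷ b₀₂   ∷ b₀₃   ∷ [])
       ∷ (b₀₁   ∷ false ∷ b₁₂   ∷ b₁₃   ∷ [])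
       ∷ (b₀₂   ∷ b₁₂   ∷ false ∷ b₂₃   ∷ [])
       ∷ (b₀₃   ∷ b₁₃   ∷ b₂₃   ∷ false ∷ []) ∷ []

adj-table₄ : ∀ G (x₀ x₁ x₂ x₃ : Fin (n G)) i j →
  adj G (lookup (x₀ ∷ x₁ ∷ x₂ ∷ x₃ ∷ []) i) (lookup (x₀ ∷ x₁ ∷ x₂ ∷ x₃ ∷ []) j)
    ≡ table₄ (adj G x₀ x₁) (adj G x₀ x₂) (adj G x₀ x₃) (adj G x₁ x₂) (adj G x₁ x₃) (adj G x₂ x₃) i j
adj-table₄ G x₀ x₁ x₂ x₃ 0F 0F = irrefl G x₀
adj-table₄ G x₀ x₁ x₂ x₃ 0F 1F = refl
adj-table₄ G x₀ x₁ x₂ x₃ 0F 2F = refl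
adj-table₄ G x₀ x₁ x₂ x₃ 0F 3F = refl
adj-table₄ G x₀ x₁ x₂ x₃ 1F 0F = adj-sym G x₁ x₀
adj-table₄ G x₀ x₁ x₂ x₃ 1F 1F = irrefl G x₁
adj-table₄ G x₀ x₁ x₂ x₃ 1F 2F = refl
adj-table₄ G x₀ x₁ x₂ x₃ 1F 3F = refl
adj-table₄ G x₀ x₁ x₂ x₃ 2F 0F = adj-sym G x₂ x₀
adj-table₄ G x₀ x₁ x₂ x₃ 2F 1F = adj-sym G x₂ x₁
adj-table₄ G x₀ x₁ x₂ x₃ 2F 2F = irrefl G x₂
adj-table₄ G x₀ x₁ x₂ x₃ 2F 3F = refl
adj-table₄ G x₀ x₁ x₂ x₃ 3F 0F = adj-sym G x₃ x₀
adj-table₄ G x₀ x₁ x₂ x₃ 3F 1F = adj-sym G x₃ x₁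
adj-table₄ G x₀ x₁ x₂ x₃ 3F 2F = adj-sym G x₃ x₂
adj-table₄ G x₀ x₁ x₂ x₃ 3F 3F = irrefl G x₃

enumeration⇒≅table₄ : ∀ G {x₀ x₁ x₂ x₃ : Fin (n G)} {b₀₁ b₀₂ b₀₃ b₁₂ b₁₃ b₂₃} →
  Unique (x₀ ∷ x₁ ∷ x₂ ∷ x₃ ∷ []) → (∀ x → x ∈ (x₀ ∷ x₁ ∷ x₂ ∷ x₃ ∷ [])) →
  adj G x₀ x₁ ≡ b₀₁ → adj G x₀ x₂ ≡ b₀₂ → adj G x₀ x₃ ≡ b₀₃ →
  adj G x₁ x₂ ≡ b₁₂ → adj G x₁ x₃ ≡ b₁₃ → adj G x₂ x₃ ≡ b₂₃ →
  ⟦ G ⟧ ≅ TableGraph (table₄ b₀₁ b₀₂ b₀₃ b₁₂ b₁₃ b₂₃)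
enumeration⇒≅table₄ G unique complete refl refl refl refl refl refl =
  enumeration⇒≅ ⟦ G ⟧ _ unique complete _ λ i j → ≡-true-⇔ (adj-table₄ G _ _ _ _ i j)

-- If yₗ is false, swapping 0 with l + 1 and the other two vertices with each other works.
claw-table≅triangle-table : ∀ y₀ y₁ y₂ → y₀ ≡ false ⊎ y₁ ≡ false ⊎ y₂ ≡ false →
  TableGraph (table₄ false false false y₂ y₁ y₀) ≅ TableGraph (table₄ y₀ y₁ y₂ false false false)
claw-table≅triangle-table true  true  true  (inj₁ ())
claw-table≅triangle-table true  true  true  (inj₂ (inj₁ ()))
claw-table≅triangle-table true  true  true  (inj₂ (inj₂ ()))
claw-table≅triangle-table false false false _ = ≅-tables-by-evaluation (1F ∷ 0F ∷ 3F ∷ 2F ∷ [])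
claw-table≅triangle-table false false true  _ = ≅-tables-by-evaluation (1F ∷ 0F ∷ 3F ∷ 2F ∷ [])
claw-table≅triangle-table false true  false _ = ≅-tables-by-evaluation (1F ∷ 0F ∷ 3F ∷ 2F ∷ [])
claw-table≅triangle-table false true  true  _ = ≅-tables-by-evaluation (1F ∷ 0F ∷ 3F ∷ 2F ∷ [])
claw-table≅triangle-table true  false false _ = ≅-tables-by-evaluation (2F ∷ 3F ∷ 0F ∷ 1F ∷ [])
claw-table≅triangle-table true  false true  _ = ≅-tables-by-evaluation (2F ∷ 3F ∷ 0F ∷ 1F ∷ [])
claw-table≅triangle-table true  true  false _ = ≅-tables-by-evaluation (3F ∷ 2F ∷ 1F ∷ 0F ∷ [])

co-claw-table≅Claw : co (TableGraph (table₄ false false false true true true)) ≅ Claw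
co-claw-table≅Claw = ≅-by-evaluation
  (λ i j → ¬? (i Fin.≟ j) ×-dec ¬? (table₄ false false false true true true i j Bool.≟ true))
  (λ i j → ((i Fin.≟ 0F) ×-dec ¬? (j Fin.≟ 0F)) ⊎-dec (¬? (i Fin.≟ 0F) ×-dec (j Fin.≟ 0F)))
  (0F ∷ 1F ∷ 2F ∷ 3F ∷ [])

-- Independent 2-sets

Covered : FinGraph → Set
Covered G = ∀ v → Σ (Indep2 G) (v ∈I_)

module Pairs (G : FinGraph) where

  _∈?_ : ∀ x (I : Indep2 G) → Dec (x ∈I I)
  x ∈? I = (x Fin.≟ fst I) ⊎-dec (x Fin.≟ snd I)

  fst≢snd : (I : Indep2 G) → fst I ≢ snd I
  fst≢snd I = <⇒≢ (lt I)

  Indep2-≡ : ∀ {I J : Indep2 G} → fst I ≡ fst J → snd I ≡ snd J → I ≡ J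
  Indep2-≡ {ind2 x y x<y nxy} {ind2 .x .y x<y′ nxy′} refl refl
    with <-irrelevant x<y x<y′ | Decidable⇒UIP.≡-irrelevant Bool._≟_ nxy nxy′
  ... | refl | refl = refl

  _≟_ : (I J : Indep2 G) → Dec (I ≡ J)
  I ≟ J with fst I Fin.≟ fst J | snd I Fin.≟ snd J
  ... | yes p | yes q = yes (Indep2-≡ p q)
  ... | no ¬p | _     = no λ { refl → ¬p refl }
  ... | yes _ | no ¬q = no λ { refl → ¬q refl }

  ∈-pair : ∀ (I : Indep2 G) {x y z} → x ≢ y → x ∈I I → y ∈I I → z ∈I I → z ≡ x ⊎ z ≡ y
  ∈-pair I x≢y (inj₁ refl) (inj₁ refl) _ = ⊥-elim (x≢y refl)
  ∈-pair I x≢y (inj₂ refl) (inj₂ refl) _ = ⊥-elim (x≢y refl)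
  ∈-pair I x≢y (inj₁ refl) (inj₂ refl) z∈I = z∈I
  ∈-pair I x≢y (inj₂ refl) (inj₁ refl) (inj₁ z≡fst) = inj₂ z≡fst
  ∈-pair I x≢y (inj₂ refl) (inj₁ refl) (inj₂ z≡snd) = inj₁ z≡snd

  ⊆⇒≡ : ∀ {I J : Indep2 G} → (∀ x → x ∈I I → x ∈I J) → I ≡ J
  ⊆⇒≡ {I} {J} I⊆J with I⊆J (fst I) (inj₁ refl) | I⊆J (snd I) (inj₂ refl)
  ... | inj₁ p | inj₂ q = Indep2-≡ p q
  ... | inj₁ p | inj₁ q = ⊥-elim (fst≢snd I (trans p (sym q)))
  ... | inj₂ p | inj₂ q = ⊥-elim (fst≢snd I (trans p (sym q)))
  ... | inj₂ p | inj₁ q = ⊥-elim (<-asym (lt I) (subst₂ _<_ (sym q) (sym p) (lt J)))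

  two-common⇒≡ : ∀ {I J : Indep2 G} {x y} → x ≢ y → x ∈I I → y ∈I I → x ∈I J → y ∈I J → I ≡ J
  two-common⇒≡ {I} {J} {x} {y} x≢y x∈I y∈I x∈J y∈J = ⊆⇒≡ λ z → ∈J ∘ ∈-pair I x≢y x∈I y∈I
    where
    ∈J : ∀ {z} → z ≡ x ⊎ z ≡ y → z ∈I J
    ∈J (inj₁ refl) = x∈J
    ∈J (inj₂ refl) = y∈J

  partner : ∀ (I : Indep2 G) {x} → x ∈I I → Σ (Fin (n G)) λ y → y ∈I I × y ≢ x
  partner I (inj₁ refl) = snd I , inj₂ refl , ≢-sym (fst≢snd I)
  partner I (inj₂ refl) = fst I , inj₁ refl , fst≢snd I

  Meet : Indep2 G → Indep2 G → Set
  Meet I J = Σ (Fin (n G)) λ x → x ∈I I × x ∈I J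

  TJ⇔≢×Meet : ∀ {I J} → TJ G I J ⇔ (I ≢ J × Meet I J)
  TJ⇔≢×Meet {I} {J} = mk⇔ sound complete
    where
    sound : TJ G I J → I ≢ J × Meet I J
    sound (x , y , x∈I , y∉I , J≈) with partner I x∈I
    ... | m , m∈I , m≢x = (λ { refl → y∉I (⇔.from (J≈ y) (inj₂ refl)) })
                        , m , m∈I , ⇔.from (J≈ m) (inj₁ (m∈I , m≢x))
    complete : I ≢ J × Meet I J → TJ G I J
    complete (I≢J , m , m∈I , m∈J) with partner I m∈I | partner J m∈J
    ... | x , x∈I , x≢m | y , y∈J , y≢m = x , y , x∈I , y∉I , λ z → mk⇔ (J⇒ z) (⇒J z)
      where
      y∉I : ¬ y ∈I I
      y∉I y∈I with ∈-pair I (≢-sym x≢m) m∈I x∈I y∈I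
      ... | inj₁ y≡m = y≢m y≡m
      ... | inj₂ refl = I≢J (two-common⇒≡ (≢-sym x≢m) m∈I x∈I m∈J y∈J)
      J⇒ : ∀ z → z ∈I J → (z ∈I I × z ≢ x) ⊎ z ≡ y
      J⇒ z z∈J with ∈-pair J (≢-sym y≢m) m∈J y∈J z∈J
      ... | inj₁ refl = inj₁ (m∈I , ≢-sym x≢m)
      ... | inj₂ z≡y = inj₂ z≡y
      ⇒J : ∀ z → (z ∈I I × z ≢ x) ⊎ z ≡ y → z ∈I J
      ⇒J z (inj₂ refl) = y∈J
      ⇒J z (inj₁ (z∈I , z≢x)) with ∈-pair I (≢-sym x≢m) m∈I x∈I z∈I
      ... | inj₁ refl = m∈J
      ... | inj₂ z≡x = ⊥-elim (z≢x z≡x)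

  pair-of-nonadjacent : ∀ {u v} → u ≢ v → adj G u v ≡ false → Σ (Indep2 G) λ I → u ∈I I × v ∈I I
  pair-of-nonadjacent {u} {v} u≢v uv with <-cmp u v
  ... | tri< u<v _ _ = ind2 u v u<v uv , inj₁ refl , inj₂ refl
  ... | tri≈ _ u≡v _ = ⊥-elim (u≢v u≡v)
  ... | tri> _ _ v<u = ind2 v u v<u (trans (adj-sym G v u) uv) , inj₂ refl , inj₁ refl

  pair⇒nonadjacent : ∀ {I : Indep2 G} {u v} → u ∈I I → v ∈I I → u ≢ v → adj G u v ≡ false
  pair⇒nonadjacent (inj₁ refl) (inj₁ refl) u≢v = ⊥-elim (u≢v refl)
  pair⇒nonadjacent (inj₂ refl) (inj₂ refl) u≢v = ⊥-elim (u≢v refl)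
  pair⇒nonadjacent {I} (inj₁ refl) (inj₂ refl) _ = nadj I
  pair⇒nonadjacent {I} (inj₂ refl) (inj₁ refl) _ = trans (adj-sym G (snd I) (fst I)) (nadj I)

  any-pair? : {P : Indep2 G → Set} → (∀ I → Dec (P I)) → Dec (Σ (Indep2 G) P)
  any-pair? {P} P? with any? (λ u → any? (at? u))
    where
    at? : ∀ u v → Dec (Σ (u < v) λ u<v → Σ (adj G u v ≡ false) λ uv → P (ind2 u v u<v uv))
    at? u v with u Fin.<? v | adj G u v Bool.≟ false
    ... | no u≮v | _     = no (u≮v ∘ proj₁)
    ... | yes _  | no ¬uv = no (¬uv ∘ proj₁ ∘ proj₂)
    ... | yes u<v | yes uv with P? (ind2 u v u<v uv)
    ...   | yes p = yes (u<v , uv , p)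
    ...   | no ¬p = no λ (u<v′ , uv′ , p) → ¬p (subst P (Indep2-≡ refl refl) p)
  ... | yes (u , v , u<v , uv , p) = yes (ind2 u v u<v uv , p)
  ... | no ¬∃ = no λ (ind2 u v u<v uv , p) → ¬∃ (u , v , u<v , uv , p)

  same-pairs⇒≡ : Covered G → (∀ I → Σ (Indep2 G) (TJ G I)) →
    ∀ {u v} → (∀ I → u ∈I I ⇔ v ∈I I) → u ≡ v
  same-pairs⇒≡ covered neighbour {u} {v} same with u Fin.≟ v
  ... | yes u≡v = u≡v
  ... | no u≢v with covered u
  ...   | I , u∈I with neighbour I
  ...     | K , I~K with ⇔.to (TJ⇔≢×Meet {I} {K}) I~K
  ...       | I≢K , x , x∈I , x∈K = ⊥-elim (I≢K (two-common⇒≡ u≢v u∈I (⇔.to (same I) u∈I) u∈K v∈K))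
    where
    u∈K×v∈K : u ∈I K × v ∈I K
    u∈K×v∈K with ∈-pair I u≢v u∈I (⇔.to (same I) u∈I) x∈I
    ... | inj₁ refl = x∈K , ⇔.to (same K) x∈K
    ... | inj₂ refl = ⇔.from (same K) x∈K , x∈K
    u∈K : u ∈I K
    u∈K = proj₁ u∈K×v∈K
    v∈K : v ∈I K
    v∈K = proj₂ u∈K×v∈K

  spanning-or-outside : (I : Indep2 G) → (∀ x → x ∈I I) ⊎ Σ (Fin (n G)) (λ x → ¬ x ∈I I)
  spanning-or-outside I with any? (λ x → ¬? (x ∈? I))
  ... | yes outside = inj₂ outside
  ... | no no-outside = inj₁ λ x → decidable-stable (x ∈? I) λ x∉I → no-outside (x , x∉I)

  spanning⇒unique : ∀ {I} → (∀ x → x ∈I I) → ∀ J → J ≡ I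
  spanning⇒unique spanning J = ⊆⇒≡ λ x _ → spanning x

  spanning⇒edgeless : ∀ {I} → (∀ x → x ∈I I) → ∀ x y → adj G x y ≡ false
  spanning⇒edgeless {I} spanning x y with x Fin.≟ y
  ... | yes refl = irrefl G x
  ... | no x≢y = pair⇒nonadjacent {I} (spanning x) (spanning y) x≢y

-- The join condition

K₁ : FinGraph
K₁ = record { n = 1 ; adj = λ _ _ → false ; sym = λ _ _ → refl ; irrefl = λ _ → refl }

K₁-has-no-indep2 : ¬ HasIndep2 ⟦ K₁ ⟧
K₁-has-no-indep2 (zero , zero , 0≢0 , _) = 0≢0 refl

_∖_ : (G : FinGraph) → Fin (n G) → FinGraph
record { n = suc m ; adj = a ; sym = s ; irrefl = i } ∖ v = record
  { n = m ; adj = λ x y → a (punchIn v x) (punchIn v y)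
  ; sym = λ x y → s (punchIn v x) (punchIn v y) ; irrefl = i ∘ punchIn v }

split-universal : ∀ G v → (∀ u → u ≢ v → adj G v u ≡ true) → ⟦ G ⟧ ≅ (⟦ K₁ ⟧ ⋈ ⟦ G ∖ v ⟧)
split-universal G@record { n = suc m ; adj = a ; sym = s ; irrefl = i } v universal = record
  { to = to ; from = from ; to∘from = to∘from ; from∘to = from∘to ; adj⇔ = adj⇔ }
  where
  to : Fin (suc m) → Fin 1 ⊎ Fin m
  to x with x Fin.≟ v
  ... | yes _ = inj₁ zero
  ... | no x≢v = inj₂ (punchOut (≢-sym x≢v))

  from : Fin 1 ⊎ Fin m → Fin (suc m)
  from (inj₁ _) = v
  from (inj₂ x) = punchIn v x

  to∘from : ∀ y → to (from y) ≡ y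
  to∘from (inj₁ zero) with v Fin.≟ v
  ... | yes _ = refl
  ... | no v≢v = ⊥-elim (v≢v refl)
  to∘from (inj₂ x) with punchIn v x Fin.≟ v
  ... | yes x↑≡v = ⊥-elim (punchInᵢ≢i v x x↑≡v)
  ... | no _ = cong inj₂ (trans (punchOut-cong v refl) (punchOut-punchIn v))

  from∘to : ∀ x → from (to x) ≡ x
  from∘to x with x Fin.≟ v
  ... | yes x≡v = sym x≡v
  ... | no x≢v = punchIn-punchOut (≢-sym x≢v)

  adj⇔ : ∀ x y → Adj ⟦ G ⟧ x y ⇔ Adj (⟦ K₁ ⟧ ⋈ ⟦ G ∖ v ⟧) (to x) (to y)
  adj⇔ x y with x Fin.≟ v | y Fin.≟ v
  ... | yes refl | yes refl = mk⇔ (⊥-elim ∘ Bool.not-¬ (i v)) λ ()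
  ... | yes refl | no y≢v = mk⇔ _ λ _ → universal y y≢v
  ... | no x≢v | yes refl = mk⇔ _ λ _ → trans (s x v) (universal x x≢v)
  ... | no x≢v | no y≢v = mk⇔ (subst (_≡ true) (sym a↑↓)) (subst (_≡ true) a↑↓)
    where
    a↑↓ : a (punchIn v (punchOut (≢-sym x≢v))) (punchIn v (punchOut (≢-sym y≢v))) ≡ a x y
    a↑↓ = cong₂ a (punchIn-punchOut (≢-sym x≢v)) (punchIn-punchOut (≢-sym y≢v))

vertex-besides : ∀ G (v : Fin (n G)) → Indep2 G → Fin (n (G ∖ v))
vertex-besides record { n = suc m } v I with fst I Fin.≟ v
... | yes refl = punchOut (Pairs.fst≢snd _ I)
... | no fst≢v = punchOut (≢-sym fst≢v)

JoinCondition⇒Covered : ∀ G → JoinCondition G → Indep2 G → Covered G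
JoinCondition⇒Covered G join I v with any? (λ u → ¬? (u Fin.≟ v) ×-dec (adj G v u Bool.≟ false))
... | yes (u , u≢v , vu) with Pairs.pair-of-nonadjacent G (≢-sym u≢v) vu
...   | J , v∈J , _ = J , v∈J
JoinCondition⇒Covered G join I v | no ¬∃ =
  ⊥-elim (K₁-has-no-indep2 (proj₁ (join K₁ (G ∖ v) zero (vertex-besides G v I) (split-universal G v universal))))
  where
  universal : ∀ u → u ≢ v → adj G v u ≡ true
  universal u u≢v = Bool.¬-not λ vu → ¬∃ (u , u≢v , vu)

-- Stars

-- A witness that f does not map the star of `centre` into a star.
record BrokenStar (G H : FinGraph) (f : Indep2 G → Indep2 H) : Set where
  constructor brokenStar
  field
    centre : Fin (n G)
    I₁ I₂ I₃ : Indep2 G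
    centre∈I₁ : centre ∈I I₁
    centre∈I₂ : centre ∈I I₂
    centre∈I₃ : centre ∈I I₃
    I₁≢I₂ : I₁ ≢ I₂
    I₁≢I₃ : I₁ ≢ I₃
    I₂≢I₃ : I₂ ≢ I₃
    apex : Fin (n H)
    apex∈fI₁ : apex ∈I f I₁
    apex∈fI₂ : apex ∈I f I₂
    apex∉fI₃ : ¬ apex ∈I f I₃

brokenStar? : ∀ G H (f : Indep2 G → Indep2 H) → Dec (BrokenStar G H f)
brokenStar? G H f = map′
  (λ (a , I₁ , I₂ , I₃ , (a∈₁ , a∈₂ , a∈₃) , (≢₁₂ , ≢₁₃ , ≢₂₃) , w , (w∈₁ , w∈₂ , w∉₃))
     → brokenStar a I₁ I₂ I₃ a∈₁ a∈₂ a∈₃ ≢₁₂ ≢₁₃ ≢₂₃ w w∈₁ w∈₂ w∉₃)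
  (λ (brokenStar a I₁ I₂ I₃ a∈₁ a∈₂ a∈₃ ≢₁₂ ≢₁₃ ≢₂₃ w w∈₁ w∈₂ w∉₃)
     → a , I₁ , I₂ , I₃ , (a∈₁ , a∈₂ , a∈₃) , (≢₁₂ , ≢₁₃ , ≢₂₃) , w , (w∈₁ , w∈₂ , w∉₃))
  (any? λ a → G.any-pair? λ I₁ → G.any-pair? λ I₂ → G.any-pair? λ I₃ →
    ((a G.∈? I₁) ×-dec (a G.∈? I₂) ×-dec (a G.∈? I₃)) ×-dec
    (¬? (I₁ G.≟ I₂) ×-dec ¬? (I₁ G.≟ I₃) ×-dec ¬? (I₂ G.≟ I₃)) ×-dec
    any? λ w → (w H.∈? f I₁) ×-dec (w H.∈? f I₂) ×-dec ¬? (w H.∈? f I₃))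
  where module G = Pairs G
        module H = Pairs H

module LineIso {G H : FinGraph} (φ : I2J G ≅ I2J H) where
  open _≅_ φ public using (to∘from; from∘to; adj⇔) renaming (to to f; from to f⁻¹)
  module G = Pairs G
  module H = Pairs H

  f-injective : ∀ {I J} → f I ≡ f J → I ≡ J
  f-injective {I} {J} fI≡fJ = trans (sym (from∘to I)) (trans (cong f⁻¹ fI≡fJ) (from∘to J))

  ∈f⁻¹f : ∀ {x I} → x ∈I f⁻¹ (f I) ⇔ x ∈I I
  ∈f⁻¹f {x} {I} = mk⇔ (subst (x ∈I_) (from∘to I)) (subst (x ∈I_) (sym (from∘to I)))

  ∈ff⁻¹ : ∀ {y J} → y ∈I f (f⁻¹ J) ⇔ y ∈I J
  ∈ff⁻¹ {y} {J} = mk⇔ (subst (y ∈I_) (to∘from J)) (subst (y ∈I_) (sym (to∘from J)))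

  f-Meet : ∀ {I J} → I ≢ J → G.Meet I J → H.Meet (f I) (f J)
  f-Meet {I} {J} I≢J I∩J =
    proj₂ (⇔.to (H.TJ⇔≢×Meet {f I} {f J}) (⇔.to (adj⇔ I J) (⇔.from (G.TJ⇔≢×Meet {I} {J}) (I≢J , I∩J))))

  f⁻¹-Meet : ∀ {I J} → I ≢ J → H.Meet (f I) (f J) → G.Meet I J
  f⁻¹-Meet {I} {J} I≢J fI∩fJ =
    proj₂ (⇔.to (G.TJ⇔≢×Meet {I} {J}) (⇔.from (adj⇔ I J) (⇔.from (H.TJ⇔≢×Meet {f I} {f J}) (I≢J ∘ f-injective , fI∩fJ))))

module StarPreserving {G H : FinGraph} (φ : I2J G ≅ I2J H)
  (intact : ¬ BrokenStar G H (_≅_.to φ)) (intact⁻¹ : ¬ BrokenStar H G (_≅_.from φ))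
  (covered : Covered G) (neighbour : ∀ I → Σ (Indep2 G) (TJ G I)) where
  open LineIso φ

  StarImage : Fin (n G) → Fin (n H) → Set
  StarImage a w = ∀ I → a ∈I I ⇔ w ∈I f I

  star-of-two : ∀ {a I₁ I₂} → a ∈I I₁ → a ∈I I₂ → I₁ ≢ I₂ → Σ (Fin (n H)) (StarImage a)
  star-of-two {a} {I₁} {I₂} a∈₁ a∈₂ ≢₁₂ with f-Meet ≢₁₂ (a , a∈₁ , a∈₂)
  ... | w , w∈₁ , w∈₂ = w , λ I → mk⇔ (forward I) (backward I)
    where
    forward : ∀ I → a ∈I I → w ∈I f I
    forward I a∈I with I G.≟ I₁ | I G.≟ I₂ | w H.∈? f I
    ... | yes refl | _ | _ = w∈₁
    ... | no _ | yes refl | _ = w∈₂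
    ... | no _ | no _ | yes w∈I = w∈I
    ... | no ≢₁ | no ≢₂ | no w∉I =
      ⊥-elim (intact (brokenStar a I₁ I₂ I a∈₁ a∈₂ a∈I ≢₁₂ (≢-sym ≢₁) (≢-sym ≢₂) w w∈₁ w∈₂ w∉I))
    backward : ∀ I → w ∈I f I → a ∈I I
    backward I w∈I with a G.∈? I
    ... | yes a∈I = a∈I
    ... | no a∉I = ⊥-elim (intact⁻¹ (brokenStar w (f I₁) (f I₂) (f I) w∈₁ w∈₂ w∈I
                     (≢₁₂ ∘ f-injective) (≢I a∈₁ ∘ f-injective) (≢I a∈₂ ∘ f-injective)
                     a (⇔.from ∈f⁻¹f a∈₁) (⇔.from ∈f⁻¹f a∈₂) (a∉I ∘ ⇔.to ∈f⁻¹f)))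
      where
      ≢I : ∀ {J} → a ∈I J → J ≢ I
      ≢I a∈J refl = a∉I a∈J

  star-of-one : ∀ {a I₁} → a ∈I I₁ → (∀ I → a ∈I I → I ≡ I₁) → Σ (Fin (n H)) (StarImage a)
  star-of-one {a} {I₁} a∈₁ only-I₁ with G.partner I₁ a∈₁ | neighbour I₁
  ... | b , b∈₁ , b≢a | K , I₁~K with ⇔.to (G.TJ⇔≢×Meet {I₁} {K}) I₁~K
  ...   | I₁≢K , x , x∈₁ , x∈K with G.∈-pair I₁ (≢-sym b≢a) a∈₁ b∈₁ x∈₁
  ...     | inj₁ refl = ⊥-elim (I₁≢K (sym (only-I₁ K x∈K)))
  ...     | inj₂ refl with star-of-two b∈₁ x∈K I₁≢K
  ...       | w′ , star-b with H.partner (f I₁) (⇔.to (star-b I₁) b∈₁)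
  ...         | w , w∈₁ , w≢w′ = w , λ I → mk⇔ (forward I) (backward I)
    where
    forward : ∀ I → a ∈I I → w ∈I f I
    forward I a∈I = subst (λ J → w ∈I f J) (sym (only-I₁ I a∈I)) w∈₁
    backward : ∀ I → w ∈I f I → a ∈I I
    backward I w∈I with a G.∈? I
    ... | yes a∈I = a∈I
    ... | no a∉I with f⁻¹-Meet I₁≢I (w , w∈₁ , w∈I)
      where I₁≢I : I₁ ≢ I
            I₁≢I refl = a∉I a∈₁
    ...   | y , y∈₁ , y∈I with G.∈-pair I₁ (≢-sym b≢a) a∈₁ b∈₁ y∈₁
    ...     | inj₁ refl = ⊥-elim (a∉I y∈I)
    ...     | inj₂ refl = ⊥-elim (a∉I (subst (a ∈I_) I₁≡I a∈₁))
      where I₁≡I : I₁ ≡ I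
            I₁≡I = f-injective (H.two-common⇒≡ w≢w′ w∈₁ (⇔.to (star-b I₁) b∈₁) w∈I (⇔.to (star-b I) y∈I))

  star : ∀ a → Σ (Fin (n H)) (StarImage a)
  star a with covered a
  ... | I₁ , a∈₁ with G.any-pair? (λ I → (a G.∈? I) ×-dec ¬? (I G.≟ I₁))
  ...   | yes (I₂ , a∈₂ , I₂≢I₁) = star-of-two a∈₁ a∈₂ (≢-sym I₂≢I₁)
  ...   | no ¬I₂ = star-of-one a∈₁ only-I₁
    where
    only-I₁ : ∀ I → a ∈I I → I ≡ I₁
    only-I₁ I a∈I with I G.≟ I₁
    ... | yes I≡I₁ = I≡I₁
    ... | no I≢I₁ = ⊥-elim (¬I₂ (I , a∈I , I≢I₁))

star-preserving⇒≅ : ∀ {G H} (φ : I2J G ≅ I2J H) →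
  ¬ BrokenStar G H (_≅_.to φ) → ¬ BrokenStar H G (_≅_.from φ) →
  Covered G → Covered H → (∀ I → Σ (Indep2 G) (TJ G I)) → (∀ J → Σ (Indep2 H) (TJ H J)) →
  ⟦ G ⟧ ≅ ⟦ H ⟧
star-preserving⇒≅ {G} {H} φ intact intact⁻¹ coveredG coveredH neighbourG neighbourH = record
  { to = F ; from = F⁻¹ ; to∘from = F∘F⁻¹ ; from∘to = F⁻¹∘F ; adj⇔ = λ x y → ≡-true-⇔ (adj-F x y) }
  where
  open LineIso φ
  module S = StarPreserving φ intact intact⁻¹ coveredG neighbourG
  module S⁻¹ = StarPreserving (≅-sym φ) intact⁻¹ intact coveredH neighbourH

  F : Fin (n G) → Fin (n H)
  F a = proj₁ (S.star a)
  F⁻¹ : Fin (n H) → Fin (n G)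
  F⁻¹ w = proj₁ (S⁻¹.star w)

  star : ∀ a I → a ∈I I ⇔ F a ∈I f I
  star a = proj₂ (S.star a)
  star⁻¹ : ∀ w J → w ∈I J ⇔ F⁻¹ w ∈I f⁻¹ J
  star⁻¹ w = proj₂ (S⁻¹.star w)

  F⁻¹∘F : ∀ a → F⁻¹ (F a) ≡ a
  F⁻¹∘F a = G.same-pairs⇒≡ coveredG neighbourG λ I →
    ⇔-sym (star a I) ⇔-∘ (⇔-sym (star⁻¹ (F a) (f I)) ⇔-∘ ⇔-sym ∈f⁻¹f)

  F∘F⁻¹ : ∀ w → F (F⁻¹ w) ≡ w
  F∘F⁻¹ w = H.same-pairs⇒≡ coveredH neighbourH λ J →
    ⇔-sym (star⁻¹ w J) ⇔-∘ (⇔-sym (star (F⁻¹ w) (f⁻¹ J)) ⇔-∘ ⇔-sym ∈ff⁻¹)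

  adj-F : ∀ x y → adj G x y ≡ adj H (F x) (F y)
  adj-F x y with x Fin.≟ y
  ... | yes refl = trans (irrefl G x) (sym (irrefl H (F x)))
  ... | no x≢y = Bool-≡ forward backward
    where
    Fx≢Fy : F x ≢ F y
    Fx≢Fy Fx≡Fy = x≢y (trans (sym (F⁻¹∘F x)) (trans (cong F⁻¹ Fx≡Fy) (F⁻¹∘F y)))
    forward : adj G x y ≡ false → adj H (F x) (F y) ≡ false
    forward xy =
      let I , x∈I , y∈I = G.pair-of-nonadjacent x≢y xy
      in H.pair⇒nonadjacent {f I} (⇔.to (star x I) x∈I) (⇔.to (star y I) y∈I) Fx≢Fy
    backward : adj H (F x) (F y) ≡ false → adj G x y ≡ false
    backward FxFy =
      let J , Fx∈J , Fy∈J = H.pair-of-nonadjacent Fx≢Fy FxFy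
      in G.pair⇒nonadjacent {f⁻¹ J} (⇔.from (star x (f⁻¹ J)) (⇔.from ∈ff⁻¹ Fx∈J))
                                    (⇔.from (star y (f⁻¹ J)) (⇔.from ∈ff⁻¹ Fy∈J)) x≢y

-- A star sent onto a triangle

third : ∀ (l l′ : Fin 3) → Σ (Fin 3) λ l″ → l″ ≢ l × l″ ≢ l′
third = from-yes (all? λ (l : Fin 3) → all? λ (l′ : Fin 3) → any? λ (l″ : Fin 3) → ¬? (l″ Fin.≟ l) ×-dec ¬? (l″ Fin.≟ l′))

others : ∀ (l : Fin 3) → Σ (Fin 3) λ s → Σ (Fin 3) λ t → s ≢ l × t ≢ l × t ≢ s
others = from-yes (all? λ (l : Fin 3) → any? λ (s : Fin 3) → any? λ (t : Fin 3) →
  ¬? (s Fin.≟ l) ×-dec ¬? (t Fin.≟ l) ×-dec ¬? (t Fin.≟ s))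

pigeonhole₃ : ∀ {l₁ l₂ s t : Fin 3} → l₁ ≢ l₂ → s ≢ l₁ → s ≢ l₂ → t ≢ l₁ → t ≢ l₂ → s ≡ t
pigeonhole₃ {l₁} {l₂} {s} {t} = from-yes
  (all? λ (l₁ : Fin 3) → all? λ (l₂ : Fin 3) → all? λ (s : Fin 3) → all? λ (t : Fin 3) →
    ¬? (l₁ Fin.≟ l₂) →-dec ¬? (s Fin.≟ l₁) →-dec ¬? (s Fin.≟ l₂) →-dec ¬? (t Fin.≟ l₁) →-dec ¬? (t Fin.≟ l₂) →-dec (s Fin.≟ t))
  l₁ l₂ s t

module BrokenStarCase {G H : FinGraph} (φ : I2J G ≅ I2J H) (broken : BrokenStar G H (_≅_.to φ))
  (connected : Connected (I2J G)) (coveredG : Covered G) (coveredH : Covered H) where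
  open LineIso φ
  open BrokenStar broken renaming (centre to a; apex to w)

  -- The sides f (spoke l) form a triangle in co H, and corner l is the vertex opposite side l.
  spokes : Vec (Indep2 G) 3
  spokes = I₁ ∷ I₂ ∷ I₃ ∷ []

  spoke : Fin 3 → Indep2 G
  spoke = lookup spokes

  spokes-unique : Unique spokes
  spokes-unique = (I₁≢I₂ ∷ I₁≢I₃ ∷ []) ∷ (I₂≢I₃ ∷ []) ∷ [] ∷ []

  a∈spoke : ∀ l → a ∈I spoke l
  a∈spoke 0F = centre∈I₁
  a∈spoke 1F = centre∈I₂
  a∈spoke 2F = centre∈I₃

  leaf : Fin 3 → Fin (n G)
  leaf l = proj₁ (G.partner (spoke l) (a∈spoke l))

  leaf∈spoke : ∀ l → leaf l ∈I spoke l
  leaf∈spoke l = proj₁ (proj₂ (G.partner (spoke l) (a∈spoke l)))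

  leaf≢a : ∀ l → leaf l ≢ a
  leaf≢a l = proj₂ (proj₂ (G.partner (spoke l) (a∈spoke l)))

  leaf-injective : ∀ {l l′} → leaf l ≡ leaf l′ → l ≡ l′
  leaf-injective {l} {l′} eq = lookup-injective spokes-unique l l′
    (G.two-common⇒≡ (≢-sym (leaf≢a l)) (a∈spoke l) (leaf∈spoke l) (a∈spoke l′) (subst (_∈I spoke l′) (sym eq) (leaf∈spoke l′)))

  spoke-members : ∀ l {x} → x ∈I spoke l → x ≡ a ⊎ x ≡ leaf l
  spoke-members l = G.∈-pair (spoke l) (≢-sym (leaf≢a l)) (a∈spoke l) (leaf∈spoke l)

  leaves-not-in-spoke : ∀ {l l′} s → l ≢ l′ → leaf l ∈I spoke s → leaf l′ ∈I spoke s → ⊥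
  leaves-not-in-spoke {l} {l′} s l≢l′ l∈s l′∈s with spoke-members s l∈s | spoke-members s l′∈s
  ... | inj₁ l≡a | _ = leaf≢a l l≡a
  ... | _ | inj₁ l′≡a = leaf≢a l′ l′≡a
  ... | inj₂ l≡s | inj₂ l′≡s = l≢l′ (leaf-injective (trans l≡s (sym l′≡s)))

  side : Fin 3 → Indep2 H
  side l = f (spoke l)

  partner-on-side₂ : ∀ l (w∈l : w ∈I side l) → l ≢ 2F → proj₁ (H.partner (side l) w∈l) ∈I side 2F
  partner-on-side₂ l w∈l l≢2 with H.partner (side l) w∈l
                                | f-Meet (l≢2 ∘ lookup-injective spokes-unique l 2F) (a , a∈spoke l , a∈spoke 2F)
  ... | x , x∈l , x≢w | y , y∈l , y∈2 with H.∈-pair (side l) (≢-sym x≢w) w∈l x∈l y∈l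
  ...   | inj₁ refl = ⊥-elim (apex∉fI₃ y∈2)
  ...   | inj₂ refl = y∈2

  corner : Fin 3 → Fin (n H)
  corner 0F = proj₁ (H.partner (side 1F) apex∈fI₂)
  corner 1F = proj₁ (H.partner (side 0F) apex∈fI₁)
  corner 2F = w

  corner∈side : ∀ {l s} → l ≢ s → corner l ∈I side s
  corner∈side {0F} {0F} l≢s = ⊥-elim (l≢s refl)
  corner∈side {0F} {1F} _ = proj₁ (proj₂ (H.partner (side 1F) apex∈fI₂))
  corner∈side {0F} {2F} _ = partner-on-side₂ 1F apex∈fI₂ λ ()
  corner∈side {1F} {0F} _ = proj₁ (proj₂ (H.partner (side 0F) apex∈fI₁))
  corner∈side {1F} {1F} l≢s = ⊥-elim (l≢s refl)
  corner∈side {1F} {2F} _ = partner-on-side₂ 0F apex∈fI₁ λ ()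
  corner∈side {2F} {0F} _ = apex∈fI₁
  corner∈side {2F} {1F} _ = apex∈fI₂
  corner∈side {2F} {2F} l≢s = ⊥-elim (l≢s refl)

  corner∉side : ∀ l → ¬ corner l ∈I side l
  corner∉side 0F c∈0 = I₁≢I₂ (f-injective (H.two-common⇒≡ (proj₂ (proj₂ (H.partner (side 1F) apex∈fI₂)))
    c∈0 apex∈fI₁ (corner∈side {0F} {1F} λ ()) apex∈fI₂))
  corner∉side 1F c∈1 = I₁≢I₂ (f-injective (H.two-common⇒≡ (proj₂ (proj₂ (H.partner (side 0F) apex∈fI₁)))
    (corner∈side {1F} {0F} λ ()) apex∈fI₁ c∈1 apex∈fI₂))
  corner∉side 2F = apex∉fI₃

  corner-injective : ∀ {l l′} → corner l ≡ corner l′ → l ≡ l′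
  corner-injective {l} {l′} eq = decidable-stable (l Fin.≟ l′) λ l≢l′ →
    corner∉side l′ (subst (_∈I side l′) eq (corner∈side l≢l′))

  side-corners : ∀ l {y} → y ∈I side l → Σ (Fin 3) λ s → s ≢ l × y ≡ corner s
  side-corners l y∈l with others l
  ... | s , t , s≢l , t≢l , t≢s with H.∈-pair (side l) (t≢s ∘ corner-injective ∘ sym) (corner∈side s≢l) (corner∈side t≢l) y∈l
  ...   | inj₁ y≡s = s , s≢l , y≡s
  ...   | inj₂ y≡t = t , t≢l , y≡t

  corners-nonadjacent : ∀ {l l′} → l ≢ l′ → adj H (corner l) (corner l′) ≡ false
  corners-nonadjacent {l} {l′} l≢l′ with third l l′
  ... | s , s≢l , s≢l′ = H.pair⇒nonadjacent {side s} (corner∈side (≢-sym s≢l)) (corner∈side (≢-sym s≢l′)) (l≢l′ ∘ corner-injective)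

  NonSpoke : Indep2 G → Set
  NonSpoke J = ∀ l → J ≢ spoke l

  spoke-or-nonspoke : ∀ J → Σ (Fin 3) (λ l → J ≡ spoke l) ⊎ NonSpoke J
  spoke-or-nonspoke J with any? (λ l → J G.≟ spoke l)
  ... | yes found = inj₁ found
  ... | no none = inj₂ λ l J≡l → none (l , J≡l)

  corner-via-spoke : ∀ {J} l → NonSpoke J → ∀ {x} → x ∈I J → x ∈I spoke l →
    Σ (Fin 3) λ s → s ≢ l × corner s ∈I f J
  corner-via-spoke {J} l ns x∈J x∈l =
    let y , y∈J , y∈l = f-Meet (ns l) (_ , x∈J , x∈l)
        s , s≢l , y≡s = side-corners l y∈l
    in s , s≢l , subst (_∈I f J) y≡s y∈J

  one-corner : ∀ {J} → NonSpoke J → ∀ l l′ → corner l ∈I f J → corner l′ ∈I f J → l ≡ l′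
  one-corner ns l l′ l∈J l′∈J = decidable-stable (l Fin.≟ l′) λ l≢l′ →
    let s , s≢l , s≢l′ = third l l′
    in ns s (f-injective
         (H.two-common⇒≡ (l≢l′ ∘ corner-injective) l∈J l′∈J (corner∈side (≢-sym s≢l)) (corner∈side (≢-sym s≢l′))))

  a∉nonspoke : ∀ {J} → NonSpoke J → ¬ a ∈I J
  a∉nonspoke ns a∈J =
    let l , _ , l∈J = corner-via-spoke 0F ns a∈J (a∈spoke 0F)
        l′ , l′≢l , l′∈J = corner-via-spoke l ns a∈J (a∈spoke l)
    in l′≢l (one-corner ns l′ l l′∈J l∈J)

  leaves-of-nonspoke : ∀ {J} → NonSpoke J → ∀ l → corner l ∈I f J → ∀ {s} → s ≢ l → leaf s ∈I J
  leaves-of-nonspoke ns l l∈J {s} s≢l with f⁻¹-Meet (ns s) (corner l , l∈J , corner∈side (≢-sym s≢l))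
  ... | y , y∈J , y∈s with spoke-members s y∈s
  ...   | inj₁ refl = ⊥-elim (a∉nonspoke ns y∈J)
  ...   | inj₂ refl = y∈J

  nonspoke-members : ∀ {J} → NonSpoke J → ∀ l → corner l ∈I f J → ∀ {x} → x ∈I J → Σ (Fin 3) λ s → s ≢ l × x ≡ leaf s
  nonspoke-members {J} ns l l∈J x∈J with others l
  ... | s , t , s≢l , t≢l , t≢s
      with G.∈-pair J (t≢s ∘ leaf-injective ∘ sym) (leaves-of-nonspoke ns l l∈J s≢l) (leaves-of-nonspoke ns l l∈J t≢l) x∈J
  ...   | inj₁ x≡s = s , s≢l , x≡s
  ...   | inj₂ x≡t = t , t≢l , x≡t

  leaf-index≢corner : ∀ {J} → NonSpoke J → ∀ s → corner s ∈I f J → ∀ {l} → leaf l ∈I J → l ≢ s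
  leaf-index≢corner ns s s∈J l∈J refl =
    let s′ , s′≢s , l≡s′ = nonspoke-members ns s s∈J l∈J in s′≢s (sym (leaf-injective l≡s′))

  InClaw : Fin (n G) → Set
  InClaw x = x ≡ a ⊎ Σ (Fin 3) λ l → x ≡ leaf l

  WithinClaw : Indep2 G → Set
  WithinClaw J = ∀ {x} → x ∈I J → InClaw x

  corner-of-nonspoke : ∀ {J} → NonSpoke J → ∀ {x} → x ∈I J → InClaw x → Σ (Fin 3) λ l → corner l ∈I f J
  corner-of-nonspoke ns x∈J (inj₁ refl) = ⊥-elim (a∉nonspoke ns x∈J)
  corner-of-nonspoke ns x∈J (inj₂ (l , refl)) =
    let s , _ , s∈J = corner-via-spoke l ns x∈J (leaf∈spoke l) in s , s∈J

  spoke-within-claw : ∀ l → WithinClaw (spoke l)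
  spoke-within-claw l = map₂ (l ,_) ∘ spoke-members l

  nonspoke-within-claw : ∀ {J} → NonSpoke J → ∀ l → corner l ∈I f J → WithinClaw J
  nonspoke-within-claw ns l l∈J y∈J = let s , _ , y≡s = nonspoke-members ns l l∈J y∈J in inj₂ (s , y≡s)

  within-claw-if-meets : ∀ J {x} → x ∈I J → InClaw x → WithinClaw J
  within-claw-if-meets J x∈J x-in with spoke-or-nonspoke J
  ... | inj₁ (l , refl) = spoke-within-claw l
  ... | inj₂ ns = let l , l∈J = corner-of-nonspoke ns x∈J x-in in nonspoke-within-claw ns l l∈J

  within-claw : ∀ J → WithinClaw J
  within-claw J = along (connected I₁ J) (within-claw-if-meets I₁ centre∈I₁ (inj₁ refl))
    where
    along : ∀ {K L} → Star (TJ G) K L → WithinClaw K → WithinClaw L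
    along ε within = within
    along {K} (_◅_ {j = M} K~M M⇝L) within with ⇔.to (G.TJ⇔≢×Meet {K} {M}) K~M
    ... | _ , x , x∈K , x∈M = along M⇝L (within-claw-if-meets M x∈M (within x∈K))

  in-claw : ∀ x → InClaw x
  in-claw x = within-claw (proj₁ (coveredG x)) (proj₂ (coveredG x))

  claw : Vec (Fin (n G)) 4
  claw = a ∷ tabulate leaf

  claw-unique : Unique claw
  claw-unique = All.tabulate⁺ (≢-sym ∘ leaf≢a) ∷ tabulate⁺ leaf-injective

  claw-complete : ∀ x → x ∈ claw
  claw-complete x with in-claw x
  ... | inj₁ refl = here refl
  ... | inj₂ (l , refl) = there (∈-tabulate⁺ leaf l)

  a-nonadjacent : ∀ l → adj G a (leaf l) ≡ false
  a-nonadjacent l = G.pair⇒nonadjacent {spoke l} (a∈spoke l) (leaf∈spoke l) (≢-sym (leaf≢a l))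

  corner-in-nonspoke : ∀ {J} → NonSpoke J → Σ (Fin 3) λ l → corner l ∈I f J
  corner-in-nonspoke {J} ns = corner-of-nonspoke ns (inj₁ refl) (in-claw (fst J))

  nonspoke-through-corner-unique : ∀ {J J′} → NonSpoke J → NonSpoke J′ → ∀ l → corner l ∈I f J → corner l ∈I f J′ → J ≡ J′
  nonspoke-through-corner-unique ns ns′ l l∈J l∈J′ =
    let s , t , s≢l , t≢l , t≢s = others l
    in G.two-common⇒≡ (t≢s ∘ leaf-injective ∘ sym)
         (leaves-of-nonspoke ns l l∈J s≢l) (leaves-of-nonspoke ns l l∈J t≢l)
         (leaves-of-nonspoke ns′ l l∈J′ s≢l) (leaves-of-nonspoke ns′ l l∈J′ t≢l)

  module OnlySpokes (only-spokes : ∀ J → Σ (Fin 3) λ l → J ≡ spoke l) where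

    I2J≅K3 : I2J G ≅ K3
    I2J≅K3 = complete-graph-≅ (I2J G) spokes spokes-unique
      (λ J → let l , J≡l = only-spokes J in subst (_∈ spokes) (sym J≡l) (∈-lookup l spokes))
      λ J K → mk⇔ proj₁ (λ J≢K → J≢K , a , a∈ J , a∈ K) ⇔-∘ G.TJ⇔≢×Meet {J} {K}
      where
      a∈ : ∀ J → a ∈I J
      a∈ J = let l , J≡l = only-spokes J in subst (a ∈I_) (sym J≡l) (a∈spoke l)

    leaves-adjacent : ∀ {l l′} → l ≢ l′ → adj G (leaf l) (leaf l′) ≡ true
    leaves-adjacent {l} {l′} l≢l′ = Bool.¬-not λ nonadjacent →
      let J , l∈J , l′∈J = G.pair-of-nonadjacent (l≢l′ ∘ leaf-injective) nonadjacent
          s , J≡s = only-spokes J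
      in leaves-not-in-spoke s l≢l′ (subst (_ ∈I_) J≡s l∈J) (subst (_ ∈I_) J≡s l′∈J)

    co-G≅Claw : co ⟦ G ⟧ ≅ Claw
    co-G≅Claw = ≅-trans
      (≅-co (enumeration⇒≅table₄ G claw-unique claw-complete
        (a-nonadjacent 0F) (a-nonadjacent 1F) (a-nonadjacent 2F)
        (leaves-adjacent {0F} {1F} λ ()) (leaves-adjacent {0F} {2F} λ ()) (leaves-adjacent {1F} {2F} λ ())))
      co-claw-table≅Claw

    corner-of-H : ∀ y → Σ (Fin 3) λ l → y ≡ corner l
    corner-of-H y =
      let K , y∈K = coveredH y
          l , f⁻¹K≡l = only-spokes (f⁻¹ K)
          s , _ , y≡s = side-corners l (subst (λ J → y ∈I f J) f⁻¹K≡l (⇔.from ∈ff⁻¹ y∈K))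
      in s , y≡s

    corners-of-H-nonadjacent : ∀ {x y} → x ≢ y → Σ (Fin 3) (λ l → x ≡ corner l) → Σ (Fin 3) (λ l → y ≡ corner l) →
      adj H x y ≡ false
    corners-of-H-nonadjacent x≢y (l , refl) (l′ , refl) = corners-nonadjacent {l} {l′} (x≢y ∘ cong corner)

    co-H≅K3 : co ⟦ H ⟧ ≅ K3
    co-H≅K3 = complete-graph-≅ (co ⟦ H ⟧) (tabulate corner) (tabulate⁺ corner-injective)
      (λ y → let l , y≡l = corner-of-H y in subst (_∈ tabulate corner) (sym y≡l) (∈-tabulate⁺ corner l))
      λ x y → mk⇔ proj₁ λ x≢y → x≢y , Bool.not-¬ (corners-of-H-nonadjacent x≢y (corner-of-H x) (corner-of-H y))

  module WithNonSpoke (J₀ : Indep2 G) (ns₀ : NonSpoke J₀) where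

    t₀ : Fin 3
    t₀ = proj₁ (corner-in-nonspoke ns₀)

    t₀∈J₀ : corner t₀ ∈I f J₀
    t₀∈J₀ = proj₂ (corner-in-nonspoke ns₀)

    z : Fin (n H)
    z = proj₁ (H.partner (f J₀) t₀∈J₀)

    z∈J₀ : z ∈I f J₀
    z∈J₀ = proj₁ (proj₂ (H.partner (f J₀) t₀∈J₀))

    z≢corner : ∀ l → z ≢ corner l
    z≢corner l z≡l = proj₂ (proj₂ (H.partner (f J₀) t₀∈J₀))
      (trans z≡l (cong corner (one-corner ns₀ l t₀ (subst (_∈I f J₀) z≡l z∈J₀) t₀∈J₀)))

    z∈nonspoke : ∀ {J} → NonSpoke J → z ∈I f J
    z∈nonspoke {J} ns with J G.≟ J₀
    ... | yes refl = z∈J₀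
    ... | no J≢J₀ =
      let s , s∈J = corner-in-nonspoke ns
          l , l≢s , l≢t₀ = third s t₀
          y , y∈J , y∈J₀ = f-Meet J≢J₀ (leaf l , leaves-of-nonspoke ns s s∈J l≢s , leaves-of-nonspoke ns₀ t₀ t₀∈J₀ l≢t₀)
      in [ (λ y≡t₀ → ⊥-elim (J≢J₀ (nonspoke-through-corner-unique ns ns₀ t₀ (subst (_∈I f J) y≡t₀ y∈J) t₀∈J₀)))
         , (λ y≡z → subst (_∈I f J) y≡z y∈J)
         ]′ (H.∈-pair (f J₀) (z≢corner t₀ ∘ sym) t₀∈J₀ z∈J₀ y∈J₀)

    H-vertices : Vec (Fin (n H)) 4
    H-vertices = z ∷ tabulate corner

    H-unique : Unique H-vertices
    H-unique = All.tabulate⁺ z≢corner ∷ tabulate⁺ corner-injective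

    H-complete : ∀ y → y ∈ H-vertices
    H-complete y =
      let K , y∈K = coveredH y
          y∈J = ⇔.from ∈ff⁻¹ y∈K
      in [ (λ (l , J≡l) → let s , _ , y≡s = side-corners l (subst (λ J → y ∈I f J) J≡l y∈J) in corner∈ s y≡s)
         , (λ ns → let s , s∈J = corner-in-nonspoke ns
                   in [ corner∈ s , here ]′ (H.∈-pair (f (f⁻¹ K)) (z≢corner s ∘ sym) s∈J (z∈nonspoke ns) y∈J))
         ]′ (spoke-or-nonspoke (f⁻¹ K))
      where
      corner∈ : ∀ s → y ≡ corner s → y ∈ H-vertices
      corner∈ s y≡s = there (subst (_∈ tabulate corner) (sym y≡s) (∈-tabulate⁺ corner s))

    adj-z-corner : ∀ {l l₁ l₂} → l₁ ≢ l₂ → l₁ ≢ l → l₂ ≢ l → adj H z (corner l) ≡ adj G (leaf l₁) (leaf l₂)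
    adj-z-corner {l} {l₁} {l₂} l₁≢l₂ l₁≢l l₂≢l = Bool-≡ forward backward
      where
      forward : adj H z (corner l) ≡ false → adj G (leaf l₁) (leaf l₂) ≡ false
      forward zl =
        let K , z∈K , l∈K = H.pair-of-nonadjacent (z≢corner l) zl
            z∈J = ⇔.from ∈ff⁻¹ z∈K
            l∈J = ⇔.from ∈ff⁻¹ l∈K
        in [ (λ (s , J≡s) → let t , _ , z≡t = side-corners s (subst (λ J → z ∈I f J) J≡s z∈J)
                            in ⊥-elim (z≢corner t z≡t))
           , (λ ns → G.pair⇒nonadjacent {f⁻¹ K} (leaves-of-nonspoke ns l l∈J l₁≢l)
                                                    (leaves-of-nonspoke ns l l∈J l₂≢l) (l₁≢l₂ ∘ leaf-injective))
           ]′ (spoke-or-nonspoke (f⁻¹ K))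
      backward : adj G (leaf l₁) (leaf l₂) ≡ false → adj H z (corner l) ≡ false
      backward l₁l₂ =
        let J , l₁∈J , l₂∈J = G.pair-of-nonadjacent (l₁≢l₂ ∘ leaf-injective) l₁l₂
        in [ (λ (s , J≡s) → ⊥-elim (leaves-not-in-spoke s l₁≢l₂ (subst (_ ∈I_) J≡s l₁∈J) (subst (_ ∈I_) J≡s l₂∈J)))
           , (λ ns → let s , s∈J = corner-in-nonspoke ns
                         s≡l = pigeonhole₃ l₁≢l₂ (≢-sym (leaf-index≢corner ns s s∈J l₁∈J)) (≢-sym (leaf-index≢corner ns s s∈J l₂∈J))
                                           (≢-sym l₁≢l) (≢-sym l₂≢l)
                     in H.pair⇒nonadjacent {f J} (z∈nonspoke ns) (subst (λ t → corner t ∈I f J) s≡l s∈J) (z≢corner l))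
           ]′ (spoke-or-nonspoke J)

    leaves-nonadjacent : ∀ t → corner t ∈I f J₀ → ∀ {s s′} → s ≢ t → s′ ≢ t → s ≢ s′ → adj G (leaf s) (leaf s′) ≡ false
    leaves-nonadjacent t t∈J₀ s≢t s′≢t s≢s′ = G.pair⇒nonadjacent {J₀}
      (leaves-of-nonspoke ns₀ t t∈J₀ s≢t) (leaves-of-nonspoke ns₀ t t∈J₀ s′≢t) (s≢s′ ∘ leaf-injective)

    some-leaves-nonadjacent : ∀ t → corner t ∈I f J₀ →
      adj G (leaf 1F) (leaf 2F) ≡ false ⊎ adj G (leaf 0F) (leaf 2F) ≡ false ⊎ adj G (leaf 0F) (leaf 1F) ≡ false
    some-leaves-nonadjacent 0F t∈J₀ = inj₁ (leaves-nonadjacent 0F t∈J₀ {1F} {2F} (λ ()) (λ ()) (λ ()))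
    some-leaves-nonadjacent 1F t∈J₀ = inj₂ (inj₁ (leaves-nonadjacent 1F t∈J₀ {0F} {2F} (λ ()) (λ ()) (λ ())))
    some-leaves-nonadjacent 2F t∈J₀ = inj₂ (inj₂ (leaves-nonadjacent 2F t∈J₀ {0F} {1F} (λ ()) (λ ()) (λ ())))

    G≅H : ⟦ G ⟧ ≅ ⟦ H ⟧
    G≅H = ≅-trans
      (enumeration⇒≅table₄ G claw-unique claw-complete
        (a-nonadjacent 0F) (a-nonadjacent 1F) (a-nonadjacent 2F) refl refl refl)
      (≅-trans (claw-table≅triangle-table _ _ _ (some-leaves-nonadjacent t₀ t₀∈J₀))
      (≅-sym (enumeration⇒≅table₄ H H-unique H-complete
        (adj-z-corner {0F} {1F} {2F} (λ ()) (λ ()) (λ ()))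
        (adj-z-corner {1F} {0F} {2F} (λ ()) (λ ()) (λ ()))
        (adj-z-corner {2F} {0F} {1F} (λ ()) (λ ()) (λ ()))
        (corners-nonadjacent {0F} {1F} (λ ())) (corners-nonadjacent {0F} {2F} (λ ())) (corners-nonadjacent {1F} {2F} (λ ())))))

  result : (⟦ G ⟧ ≅ ⟦ H ⟧) ⊎ ((I2J G ≅ K3) × (co ⟦ G ⟧ ≅ Claw) × (co ⟦ H ⟧ ≅ K3))
  result with G.any-pair? (λ J → all? λ l → ¬? (J G.≟ spoke l))
  ... | yes (J₀ , ns₀) = inj₁ (WithNonSpoke.G≅H J₀ ns₀)
  ... | no no-nonspoke = inj₂ (I2J≅K3 , co-G≅Claw , co-H≅K3)
    where
    only-spokes : ∀ J → Σ (Fin 3) λ l → J ≡ spoke l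
    only-spokes J = [ id , (λ ns → ⊥-elim (no-nonspoke (J , ns))) ]′ (spoke-or-nonspoke J)
    open OnlySpokes only-spokes

spanning-pair⇒≅ : ∀ {G H} (I : Indep2 G) (J : Indep2 H) → (∀ x → x ∈I I) → (∀ y → y ∈I J) → ⟦ G ⟧ ≅ ⟦ H ⟧
spanning-pair⇒≅ I J spanningI spanningJ = ≅-trans (edgeless₂ I spanningI) (≅-sym (edgeless₂ J spanningJ))
  where
  edgeless₂ : ∀ {G} (I : Indep2 G) → (∀ x → x ∈I I) → ⟦ G ⟧ ≅ TableGraph {2} λ _ _ → false
  edgeless₂ {G} I spanning = enumeration⇒≅ ⟦ G ⟧ (fst I ∷ snd I ∷ []) ((Pairs.fst≢snd G I ∷ []) ∷ [] ∷ [])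
    (λ x → [ here , there ∘ here ]′ (spanning x)) _
    λ i j → ≡-true-⇔ (Pairs.spanning⇒edgeless G {I} spanning _ _)

spanning-image : ∀ {G H} (φ : I2J G ≅ I2J H) → Covered H → ∀ {I} → (∀ x → x ∈I I) → ∀ y → y ∈I _≅_.to φ I
spanning-image φ coveredH spanning y =
  let K , y∈K = coveredH y
  in subst (λ J → y ∈I f J) (G.spanning⇒unique spanning (f⁻¹ K)) (⇔.from ∈ff⁻¹ y∈K)
  where open LineIso φ

Conclusion : FinGraph → FinGraph → Set
Conclusion G H = (⟦ G ⟧ ≅ ⟦ H ⟧) ⊎ ((I2J G ≅ K3) × ((co ⟦ G ⟧ ≅ K3) ⊎ (co ⟦ G ⟧ ≅ Claw)))

whitney : ∀ {G H} (φ : I2J G ≅ I2J H) → Connected (I2J G) → Connected (I2J H) → Covered G → Covered H →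
  (∀ I → Σ (Indep2 G) (TJ G I)) → (∀ J → Σ (Indep2 H) (TJ H J)) → Conclusion G H
whitney {G} {H} φ connectedG connectedH coveredG coveredH neighbourG neighbourH
  with brokenStar? G H (_≅_.to φ) | brokenStar? H G (_≅_.from φ)
... | yes broken | _ = [ inj₁ , (λ (I2JG≅K3 , coG≅Claw , _) → inj₂ (I2JG≅K3 , inj₂ coG≅Claw)) ]′
  (BrokenStarCase.result φ broken connectedG coveredG coveredH)
... | no _ | yes broken⁻¹ = [ inj₁ ∘ ≅-sym , (λ (I2JH≅K3 , _ , coG≅K3) → inj₂ (≅-trans φ I2JH≅K3 , inj₁ coG≅K3)) ]′
  (BrokenStarCase.result (≅-sym φ) broken⁻¹ connectedH coveredH coveredG)
... | no intact | no intact⁻¹ = inj₁ (star-preserving⇒≅ φ intact intact⁻¹ coveredG coveredH neighbourG neighbourH)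

proposition4p8 : (G H : FinGraph) →
    NonEmpty (I2J G) → Connected (I2J G) →
    NonEmpty (I2J H) → Connected (I2J H) →
    JoinCondition G → JoinCondition H →
    I2J G ≅ I2J H →
    (⟦ G ⟧ ≅ ⟦ H ⟧) ⊎ ((I2J G ≅ K3) × ((co ⟦ G ⟧ ≅ K3) ⊎ (co ⟦ G ⟧ ≅ Claw)))
proposition4p8 G H I₀ connectedG J₀ connectedH joinG joinH φ = [ single-pair , two-pairs ]′ (G.spanning-or-outside I₀)
  where
  open LineIso φ
  coveredG : Covered G
  coveredG = JoinCondition⇒Covered G joinG I₀
  coveredH : Covered H
  coveredH = JoinCondition⇒Covered H joinH J₀

  single-pair : (∀ x → x ∈I I₀) → Conclusion G H
  single-pair spanning = inj₁ (spanning-pair⇒≅ I₀ (f I₀) spanning (spanning-image φ coveredH spanning))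

  two-pairs : Σ (Fin (n G)) (λ v → ¬ v ∈I I₀) → Conclusion G H
  two-pairs (v , v∉I₀) = whitney φ connectedG connectedH coveredG coveredH
    (connected⇒neighbour (I2J G) connectedG G._≟_ I₁≢I₀)
    (connected⇒neighbour (I2J H) connectedH H._≟_ (I₁≢I₀ ∘ f-injective))
    where
    I₁ : Indep2 G
    I₁ = proj₁ (coveredG v)
    I₁≢I₀ : I₁ ≢ I₀
    I₁≢I₀ I₁≡I₀ = v∉I₀ (subst (v ∈I_) I₁≡I₀ (proj₂ (coveredG v)))
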